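{- Let $G$ be a graph and $\mathcal{P}$ a maximal $P_2$-packing of $G$ of size $j$. If $G$ has a $P_2$-packing of size $j+1$, then there is a packing $\mathcal{Q}\in\mathfrak{Q}_{(2)}$ such that $|V(\mathcal{P})\cap V(\mathcal{Q})|\ge 2.5j$.
   Context: A $P_2$ is a path with three vertices and two edges. A $P_2$-packing is a set of pairwise vertex-disjoint $P_2$'s in $G$; it is maximal if no further $P_2$ vertex-disjoint from all members can be added. $V(\cdot)$, $E(\cdot)$ denote vertex/edge sets (unions for sets of paths). $\mathfrak{Q}_{(1)}$ is the set of $P_2$-packings $\mathcal{Q}$ of $G$ of size $j+1$ maximizing $\sum_{p\in\mathcal{P}}\sum_{q\in\mathcal{Q}}1_{[E(p)=E(q)]}$; $\mathfrak{Q}_{(2)}$ is the set of those $\mathcal{Q}\in\mathfrak{Q}_{(1)}$ maximizing $\sum_{p\in\mathcal{P}}\sum_{q\in\mathcal{Q}}|E(p)\cap E(q)|$. -}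

module Defs where

open import Data.Nat using (ℕ; zero; suc; _+_; _*_; _≤_)
open import Data.Bool using (Bool; true; false; _∧_; _∨_; if_then_else_)
open import Data.Fin using (Fin; _≟_)
open import Data.List using (List; []; _∷_; length; map)
open import Data.Nat.ListAction using (sum)
open import Data.List.Relation.Unary.AllPairs using (AllPairs)
open import Data.List.Relation.Unary.All using (All)
open import Data.Product using (Σ; _×_; ∃)
open import Data.Empty using (⊥)
open import Relation.Nullary using (¬_)
open import Relation.Nullary.Decidable using (⌊_⌋)
open import Relation.Binary.PropositionalEquality using (_≡_; _≢_)
open import Data.List.Base using (allFin)

record Graph (n : ℕ) : Set where
  field
    adj   : Fin n → Fin n → Bool
    sym   : ∀ u v → adj u v ≡ adj v u
    irrefl : ∀ v → adj v v ≡ false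
open Graph public

countB : {A : Set} → (A → Bool) → List A → ℕ
countB f [] = 0
countB f (x ∷ xs) = (if f x then 1 else 0) + countB f xs

module _ {n : ℕ} (G : Graph n) where

  -- A P₂ : path a - b - c (three distinct vertices, edges ab and bc).
  -- (a ≢ b and b ≢ c follow from irreflexivity.)
  record P2 : Set where
    constructor path
    field
      a b c : Fin n
      ab : adj G a b ≡ true
      bc : adj G b c ≡ true
      a≢c : a ≢ c

  open P2 public

  _==_ : Fin n → Fin n → Bool
  u == v = ⌊ u ≟ v ⌋

  inV : Fin n → P2 → Bool
  inV v p = (v == a p) ∨ ((v == b p) ∨ (v == c p))

  Disjoint : P2 → P2 → Set
  Disjoint p q = ∀ v → inV v p ≡ true → inV v q ≡ true → ⊥

  IsPacking : List P2 → Set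
  IsPacking = AllPairs Disjoint

  IsMaximalPacking : List P2 → Set
  IsMaximalPacking P = IsPacking P × (¬ Σ P2 (λ q → All (Disjoint q) P))

  inVs : Fin n → List P2 → Bool
  inVs v [] = false
  inVs v (p ∷ ps) = inV v p ∨ inVs v ps

  commonVertices : List P2 → List P2 → ℕ
  commonVertices P Q = countB (λ v → inVs v P ∧ inVs v Q) (allFin n)

  sameEdge : Fin n → Fin n → Fin n → Fin n → Bool
  sameEdge x y u v = ((x == u) ∧ (y == v)) ∨ ((x == v) ∧ (y == u))

  edgeIn : Fin n → Fin n → P2 → Bool
  edgeIn x y q = sameEdge x y (a q) (b q) ∨ sameEdge x y (b q) (c q)

  edgesSub : P2 → P2 → Bool
  edgesSub p q = edgeIn (a p) (b p) q ∧ edgeIn (b p) (c p) q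

  ind : Bool → ℕ
  ind true = 1
  ind false = 0

  sameEdges : P2 → P2 → ℕ
  sameEdges p q = ind (edgesSub p q ∧ edgesSub q p)

  -- |E(p) ∩ E(q)|  (the two edges of p are distinct)
  edgeOverlap : P2 → P2 → ℕ
  edgeOverlap p q = ind (edgeIn (a p) (b p) q) + ind (edgeIn (b p) (c p) q)

  doubleSum : (P2 → P2 → ℕ) → List P2 → List P2 → ℕ
  doubleSum f P Q = sum (map (λ p → sum (map (λ q → f p q) Q)) P)

  score₁ : List P2 → List P2 → ℕ
  score₁ = doubleSum sameEdges

  score₂ : List P2 → List P2 → ℕ
  score₂ = doubleSum edgeOverlap

  InQ1 : List P2 → ℕ → List P2 → Set
  InQ1 P j Q = IsPacking Q × length Q ≡ suc j
             × (∀ Q' → IsPacking Q' → length Q' ≡ suc j → score₁ P Q' ≤ score₁ P Q)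

  InQ2 : List P2 → ℕ → List P2 → Set
  InQ2 P j Q = InQ1 P j Q × (∀ Q' → InQ1 P j Q' → score₂ P Q' ≤ score₂ P Q)

module Submission where

-- Theorem 5: for a (maximal) P₂-packing 𝒫 of size j in a graph with a P₂-packing of
-- size j+1, some 𝒬 ∈ 𝔔₍₂₎ has |V(𝒫) ∩ V(𝒬)| ≥ 2.5 j.
--
-- Replacing a member of 𝒬 by a path avoiding the others gives another
-- packing of size j+1, so by optimality no such swap improves the scores.  These swaps
-- show that each p ∈ 𝒫 has at most one uncovered vertex (p is then bad), that each bad p
-- is linked to a good p' ∈ 𝒫 (some q ∈ 𝒬 meets p and has an edge inside p'), and that each
-- good p' receives at most one link.  Hence 2·#bad ≤ j, while counting covered vertices
-- gives 3j ≤ |V(𝒫) ∩ V(𝒬)| + #bad; together 5j ≤ 2|V(𝒫) ∩ V(𝒬)|.  `Enumeration` and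
-- `Optimum` show 𝔔₍₂₎ ≠ ∅: a P₂ matters only through its vertex triple, so finitely many
-- candidate families suffice and score₁, then score₂, can be maximised over them.

open import Defs renaming (sym to adj-sym)
open import Data.Nat using (ℕ; zero; suc; _+_; _*_; _≤_; _<_; z≤n; s≤s; s≤s⁻¹; _<?_)
import Data.Nat as ℕ
open import Data.Nat.Properties
  using (≤-refl; ≤-trans; ≤-antisym; ≤-reflexive; <⇒≤; <⇒≱; ≮⇒≥; n≤0⇒n≡0; m≤m+n; m≤n+m; +-comm; +-assoc;
         +-identityʳ; +-suc; n<1+n; +-mono-≤; +-monoˡ-≤; +-monoʳ-≤; +-cancelˡ-≤; *-zeroʳ; *-suc;
         *-identityˡ; *-monoʳ-≤; *-distribˡ-+; +-cancelʳ-≤; +-commutativeSemigroup; module ≤-Reasoning)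
open import Data.Nat.Tactic.RingSolver using (solve-∀)
open import Algebra.Properties.CommutativeSemigroup +-commutativeSemigroup using (interchange)
open import Data.Bool using (Bool; true; false; _∧_; _∨_; not)
open import Data.Bool.Properties using (∨-zeroʳ; ∧-conicalˡ; ∧-conicalʳ)
import Data.Bool.Properties as Bool
open import Data.Fin using (Fin; zero; suc; _≟_)
open import Data.Fin.Properties using (all?)
open import Data.List using (List; []; _∷_; length; map; _++_; allFin; concatMap; cartesianProductWith)
open import Data.Bool.ListAction using (any)
open import Data.Nat.ListAction using (sum)
open import Data.List.Membership.Propositional using (_∈_; find; lose)
open import Data.List.Membership.Propositional.Properties
  using (∈-++⁺ʳ; ∈-∃++; ∈-allFin; ∈-concatMap⁺; ∈-cartesianProductWith⁺)
open import Data.List.Relation.Unary.Any using (here; there; any?)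
open import Data.List.Relation.Unary.All using (All; []; _∷_; lookup; tabulate)
open import Data.List.Relation.Unary.All.Properties using (¬Any⇒All¬)
open import Data.List.Relation.Unary.AllPairs using (AllPairs; []; _∷_; allPairs?)
open import Data.List.Relation.Binary.Pointwise using (Pointwise; []; _∷_; Pointwise-length)
open import Data.Product using (Σ; _×_; _,_; proj₁; proj₂)
open import Data.Sum using (_⊎_; inj₁; inj₂)
open import Data.Empty using (⊥; ⊥-elim)
open import Function using (_∘_)
open import Relation.Nullary using (¬_; Dec; yes; no)
open import Relation.Nullary.Decidable using (from-yes; _→-dec_; _⊎-dec_; _×-dec_; ¬?)
open import Relation.Binary.PropositionalEquality

∨-elim : ∀ {x y} → x ∨ y ≡ true → x ≡ true ⊎ y ≡ true
∨-elim {true} _ = inj₁ refl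
∨-elim {false} e = inj₂ e

∨-introˡ : ∀ {x} y → x ≡ true → x ∨ y ≡ true
∨-introˡ y refl = refl

∨-introʳ : ∀ x {y} → y ≡ true → x ∨ y ≡ true
∨-introʳ x refl = ∨-zeroʳ x

∧-elim : ∀ {x y} → x ∧ y ≡ true → x ≡ true × y ≡ true
∧-elim {x} {y} e = ∧-conicalˡ x y e , ∧-conicalʳ x y e

∧-intro : ∀ {x y} → x ≡ true → y ≡ true → x ∧ y ≡ true
∧-intro refl refl = refl

∧-weakenˡ : ∀ x y {g} → x ∧ g ≡ true → (x ∨ y) ∧ g ≡ true
∧-weakenˡ true y e = e

∧-weakenʳ : ∀ x y {g} → y ∧ g ≡ true → (x ∨ y) ∧ g ≡ true
∧-weakenʳ true true e = e
∧-weakenʳ false true e = e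

apart : ∀ {A : Set} (f : A → Bool) {x y} → f x ≡ true → f y ≡ false → x ≢ y
apart f fx fy refl with () ← trans (sym fx) fy

any-elim : ∀ {A : Set} (g : A → Bool) xs → any g xs ≡ true → Σ A λ x → x ∈ xs × g x ≡ true
any-elim g (x ∷ xs) e with ∨-elim {g x} e
... | inj₁ gx = x , here refl , gx
... | inj₂ rest = let (y , y∈ , gy) = any-elim g xs rest in y , there y∈ , gy

any-intro : ∀ {A : Set} (g : A → Bool) xs {x} → x ∈ xs → g x ≡ true → any g xs ≡ true
any-intro g (y ∷ xs) (here refl) gx = ∨-introˡ (any g xs) gx
any-intro g (y ∷ xs) (there x∈) gx = ∨-introʳ (g y) (any-intro g xs x∈ gx)

trade : ∀ {a b x y} → a + x ≡ b + y → a ≤ b → y ≤ x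
trade {a} {b} {x} {y} e a≤b = +-cancelˡ-≤ b y x (subst (_≤ b + x) e (+-monoˡ-≤ x a≤b))

trade′ : ∀ {a b x y} → a + x ≡ b + y → x ≤ y → b ≤ a
trade′ {a} {b} {x} {y} e = trade (trans (+-comm x a) (trans e (+-comm b y)))

five-halves : ∀ {j s b} → 3 * j ≤ s + b → 2 * b ≤ j → 5 * j ≤ 2 * s
five-halves {j} {s} {b} three-j two-b = +-cancelʳ-≤ j (5 * j) (2 * s) (begin
    5 * j + j      ≡⟨ six-j j ⟩
    2 * (3 * j)    ≤⟨ *-monoʳ-≤ 2 three-j ⟩
    2 * (s + b)    ≡⟨ *-distribˡ-+ 2 s b ⟩
    2 * s + 2 * b  ≤⟨ +-monoʳ-≤ (2 * s) two-b ⟩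
    2 * s + j      ∎)
  where
  open ≤-Reasoning
  six-j : ∀ j → 5 * j + j ≡ 2 * (3 * j)
  six-j = solve-∀

Σ[_] : {A : Set} → List A → (A → ℕ) → ℕ
Σ[ xs ] f = sum (map f xs)

module _ {A : Set} where

  sum-cong : ∀ xs {f g : A → ℕ} → (∀ {x} → x ∈ xs → f x ≡ g x) → Σ[ xs ] f ≡ Σ[ xs ] g
  sum-cong [] h = refl
  sum-cong (x ∷ xs) h = cong₂ _+_ (h (here refl)) (sum-cong xs (h ∘ there))

  sum-mono : ∀ xs {f g : A → ℕ} → (∀ {x} → x ∈ xs → f x ≤ g x) → Σ[ xs ] f ≤ Σ[ xs ] g
  sum-mono [] h = z≤n
  sum-mono (x ∷ xs) h = +-mono-≤ (h (here refl)) (sum-mono xs (h ∘ there))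

  sum-zero : ∀ xs {f : A → ℕ} → (∀ {x} → x ∈ xs → f x ≡ 0) → Σ[ xs ] f ≡ 0
  sum-zero [] h = refl
  sum-zero (x ∷ xs) h rewrite h (here refl) = sum-zero xs (h ∘ there)

  sum-+ : ∀ xs (f g : A → ℕ) → Σ[ xs ] (λ x → f x + g x) ≡ Σ[ xs ] f + Σ[ xs ] g
  sum-+ [] f g = refl
  sum-+ (x ∷ xs) f g =
    trans (cong (f x + g x +_) (sum-+ xs f g)) (interchange (f x) (g x) (Σ[ xs ] f) (Σ[ xs ] g))

  sum-const : ∀ xs k → Σ[ xs ] (λ (_ : A) → k) ≡ k * length xs
  sum-const [] k = sym (*-zeroʳ k)
  sum-const (x ∷ xs) k = trans (cong (k +_) (sum-const xs k)) (sym (*-suc k (length xs)))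

  term≤sum : ∀ {xs} (f : A → ℕ) {y} → y ∈ xs → f y ≤ Σ[ xs ] f
  term≤sum {x ∷ xs} f (here refl) = m≤m+n (f x) _
  term≤sum {x ∷ xs} f (there y∈) = ≤-trans (term≤sum f y∈) (m≤n+m _ (f x))

  vanishing-term : ∀ xs (f : A → ℕ) → Σ[ xs ] f < length xs → Σ A λ x → x ∈ xs × f x ≡ 0
  vanishing-term (x ∷ xs) f lt with f x in fx
  ... | zero = x , here refl , fx
  ... | suc k = let (y , y∈ , fy) = vanishing-term xs f (≤-trans (s≤s (m≤n+m _ k)) (s≤s⁻¹ lt)) in
                y , there y∈ , fy

  at-most-one : ∀ {R : A → A → Set} {xs} (f : A → ℕ) → AllPairs R xs → (∀ x → f x ≤ 1) →
    (∀ {x y} → x ∈ xs → y ∈ xs → 0 < f x → 0 < f y → R x y → ⊥) → Σ[ xs ] f ≤ 1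
  at-most-one f [] bound excl = z≤n
  at-most-one {xs = x ∷ xs} f (Rx ∷ Rs) bound excl with f x in fx
  ... | zero = at-most-one f Rs bound (λ x∈ y∈ → excl (there x∈) (there y∈))
  ... | suc k = begin
      suc k + Σ[ xs ] f  ≡⟨ cong (suc k +_) (sum-zero xs others-vanish) ⟩
      suc k + 0          ≡⟨ +-identityʳ (suc k) ⟩
      suc k              ≡⟨ sym fx ⟩
      f x                ≤⟨ bound x ⟩
      1                  ∎
    where
    open ≤-Reasoning
    others-vanish : ∀ {y} → y ∈ xs → f y ≡ 0
    others-vanish {y} y∈ = n≤0⇒n≡0 (≮⇒≥ λ fy>0 →
      excl (here refl) (there y∈) (subst (0 <_) (sym fx) (s≤s z≤n)) fy>0 (lookup Rx y∈))

module _ {A B : Set} where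

  sum-swap : ∀ (xs : List A) (ys : List B) (f : A → B → ℕ) →
    Σ[ xs ] (λ x → Σ[ ys ] (f x)) ≡ Σ[ ys ] (λ y → Σ[ xs ] (λ x → f x y))
  sum-swap [] ys f = sym (sum-zero ys (λ _ → refl))
  sum-swap (x ∷ xs) ys f =
    trans (cong (Σ[ ys ] (f x) +_) (sum-swap xs ys f)) (sym (sum-+ ys (f x) (λ y → Σ[ xs ] (λ x → f x y))))

module _ {A : Set} where

  countB-disjoint : ∀ (xs : List A) (f₁ f₂ h : A → Bool) → (∀ x → f₁ x ≡ true → f₂ x ≡ true → ⊥) →
    (∀ x → f₁ x ≡ true → h x ≡ true) → (∀ x → f₂ x ≡ true → h x ≡ true) →
    countB f₁ xs + countB f₂ xs ≤ countB h xs
  countB-disjoint [] f₁ f₂ h disj sub₁ sub₂ = z≤n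
  countB-disjoint (x ∷ xs) f₁ f₂ h disj sub₁ sub₂ with f₁ x in e₁ | f₂ x in e₂ | h x in e
  ... | true  | true  | _     = ⊥-elim (disj x e₁ e₂)
  ... | true  | false | false with () ← trans (sym (sub₁ x e₁)) e
  ... | false | true  | false with () ← trans (sym (sub₂ x e₂)) e
  ... | true  | false | true  = s≤s (countB-disjoint xs f₁ f₂ h disj sub₁ sub₂)
  ... | false | true  | true  rewrite +-suc (countB f₁ xs) (countB f₂ xs) =
    s≤s (countB-disjoint xs f₁ f₂ h disj sub₁ sub₂)
  ... | false | false | true  = ≤-trans (countB-disjoint xs f₁ f₂ h disj sub₁ sub₂) (m≤n+m _ 1)
  ... | false | false | false = countB-disjoint xs f₁ f₂ h disj sub₁ sub₂

  countB-witness : ∀ (xs : List A) (f : A → Bool) {x} → x ∈ xs → f x ≡ true → 1 ≤ countB f xs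
  countB-witness (y ∷ xs) f (here refl) fx rewrite fx = s≤s z≤n
  countB-witness (y ∷ xs) f (there x∈) fx = ≤-trans (countB-witness xs f x∈ fx) (m≤n+m _ _)

module _ {A : Set} where

  ∈-replaced : ∀ {y : A} L R r → y ∈ L ++ r ∷ R → y ≡ r ⊎ y ∈ L ++ R
  ∈-replaced [] R r (here e) = inj₁ e
  ∈-replaced [] R r (there y∈) = inj₂ y∈
  ∈-replaced (x ∷ L) R r (here e) = inj₂ (here e)
  ∈-replaced (x ∷ L) R r (there y∈) with ∈-replaced L R r y∈
  ... | inj₁ e = inj₁ e
  ... | inj₂ y∈′ = inj₂ (there y∈′)

  ∈-inserted : ∀ {y : A} L R q → y ∈ L ++ R → y ∈ L ++ q ∷ R
  ∈-inserted [] R q y∈ = there y∈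
  ∈-inserted (x ∷ L) R q (here e) = here e
  ∈-inserted (x ∷ L) R q (there y∈) = there (∈-inserted L R q y∈)

  length-replaced : ∀ L R (q r : A) → length (L ++ r ∷ R) ≡ length (L ++ q ∷ R)
  length-replaced [] R q r = refl
  length-replaced (x ∷ L) R q r = cong suc (length-replaced L R q r)

  sum-replaced : ∀ L R (q r : A) (f : A → ℕ) → Σ[ L ++ r ∷ R ] f + f q ≡ Σ[ L ++ q ∷ R ] f + f r
  sum-replaced [] R q r f = begin
      (f r + Σ[ R ] f) + f q  ≡⟨ +-assoc (f r) _ (f q) ⟩
      f r + (Σ[ R ] f + f q)  ≡⟨ cong (f r +_) (+-comm (Σ[ R ] f) (f q)) ⟩
      f r + (f q + Σ[ R ] f)  ≡⟨ +-comm (f r) _ ⟩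
      (f q + Σ[ R ] f) + f r  ∎
    where open ≡-Reasoning
  sum-replaced (x ∷ L) R q r f = begin
      (f x + Σ[ L ++ r ∷ R ] f) + f q  ≡⟨ +-assoc (f x) _ (f q) ⟩
      f x + (Σ[ L ++ r ∷ R ] f + f q)  ≡⟨ cong (f x +_) (sum-replaced L R q r f) ⟩
      f x + (Σ[ L ++ q ∷ R ] f + f r)  ≡⟨ sym (+-assoc (f x) _ (f r)) ⟩
      (f x + Σ[ L ++ q ∷ R ] f) + f r  ∎
    where open ≡-Reasoning

module _ {A : Set} (Admissible : A → Set) (admissible? : ∀ x → Dec (Admissible x)) (f : A → ℕ) where

  maximize : ∀ xs {x₀} → Admissible x₀ →
    Σ A λ m → Admissible m × f x₀ ≤ f m × (∀ {y} → y ∈ xs → Admissible y → f y ≤ f m)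
  maximize [] {x₀} adm₀ = x₀ , adm₀ , ≤-refl , λ ()
  maximize (x ∷ xs) {x₀} adm₀ with admissible? x | f x₀ <? f x
  ... | yes adm | yes lt =
    let (m , admₘ , ge , best) = maximize xs adm in
    m , admₘ , ≤-trans (<⇒≤ lt) ge , λ { (here refl) _ → ge ; (there y∈) → best y∈ }
  ... | yes adm | no ¬lt =
    let (m , admₘ , ge , best) = maximize xs adm₀ in
    m , admₘ , ge , λ { (here refl) _ → ≤-trans (≮⇒≥ ¬lt) ge ; (there y∈) → best y∈ }
  ... | no ¬adm | _ =
    let (m , admₘ , ge , best) = maximize xs adm₀ in
    m , admₘ , ge , λ { (here refl) adm → ⊥-elim (¬adm adm) ; (there y∈) → best y∈ }

Exhausts : Fin 3 → Fin 3 → Fin 3 → Fin 3 → Set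
Exhausts i j k l = i ≢ j → i ≢ k → j ≢ k → l ≡ i ⊎ l ≡ j ⊎ l ≡ k

fin3-exhausted : ∀ i j k l → Exhausts i j k l
fin3-exhausted = from-yes (all? λ i → all? λ j → all? λ k → all? λ l → exhausts? i j k l)
  where
  exhausts? : ∀ i j k l → Dec (Exhausts i j k l)
  exhausts? i j k l = ¬? (i ≟ j) →-dec ¬? (i ≟ k) →-dec ¬? (j ≟ k) →-dec (l ≟ i ⊎-dec l ≟ j ⊎-dec l ≟ k)

module Paths {n : ℕ} (G : Graph n) where

  PT : Set
  PT = P2 G

  𝟙 : Bool → ℕ
  𝟙 = ind G

  𝟙-true : ∀ {x} → x ≡ true → 1 ≤ 𝟙 x
  𝟙-true refl = s≤s z≤n

  𝟙-positive : ∀ x → 0 < 𝟙 x → x ≡ true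
  𝟙-positive true _ = refl

  𝟙-≤ : ∀ x {m} → (x ≡ true → 1 ≤ m) → 𝟙 x ≤ m
  𝟙-≤ true h = h refl
  𝟙-≤ false h = z≤n

  𝟙-not : ∀ x → 𝟙 x + 𝟙 (not x) ≡ 1
  𝟙-not true = refl
  𝟙-not false = refl

  𝟙≤1 : ∀ x → 𝟙 x ≤ 1
  𝟙≤1 true = s≤s z≤n
  𝟙≤1 false = z≤n

  _≐_ : Fin n → Fin n → Bool
  _≐_ = _==_ G

  ≐-refl : ∀ x → x ≐ x ≡ true
  ≐-refl x with x ≟ x
  ... | yes _ = refl
  ... | no x≢x = ⊥-elim (x≢x refl)

  ≐-sound : ∀ {x y} → x ≐ y ≡ true → x ≡ y
  ≐-sound {x} {y} e with x ≟ y
  ... | yes x≡y = x≡y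

  _∈V_ : Fin n → PT → Set
  v ∈V p = inV G v p ≡ true

  ∈V-elim : ∀ {v} (p : PT) → v ∈V p → v ≡ a p ⊎ v ≡ b p ⊎ v ≡ c p
  ∈V-elim {v} p e with ∨-elim {v ≐ a p} e
  ... | inj₁ e₁ = inj₁ (≐-sound e₁)
  ... | inj₂ e₂ with ∨-elim {v ≐ b p} e₂
  ...   | inj₁ e₃ = inj₂ (inj₁ (≐-sound e₃))
  ...   | inj₂ e₄ = inj₂ (inj₂ (≐-sound e₄))

  a∈V : ∀ (p : PT) → a p ∈V p
  a∈V p = ∨-introˡ ((a p ≐ b p) ∨ (a p ≐ c p)) (≐-refl (a p))

  b∈V : ∀ (p : PT) → b p ∈V p
  b∈V p = ∨-introʳ (b p ≐ a p) (∨-introˡ (b p ≐ c p) (≐-refl (b p)))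

  c∈V : ∀ (p : PT) → c p ∈V p
  c∈V p = ∨-introʳ (c p ≐ a p) (∨-introʳ (c p ≐ b p) (≐-refl (c p)))

  a≢b : ∀ (p : PT) → a p ≢ b p
  a≢b p e with trans (sym (subst (λ z → adj G z (b p) ≡ true) e (ab p))) (irrefl G (b p))
  ... | ()

  b≢c : ∀ (p : PT) → b p ≢ c p
  b≢c p e with trans (sym (subst (λ z → adj G z (c p) ≡ true) e (bc p))) (irrefl G (c p))
  ... | ()

  -- Indexing V(p) by Fin 3 turns counting arguments on V(p) into finite checks on Fin 3.
  vertex : PT → Fin 3 → Fin n
  vertex p zero = a p
  vertex p (suc zero) = b p
  vertex p (suc (suc zero)) = c p

  vertex-index : ∀ {v} (p : PT) → v ∈V p → Σ (Fin 3) λ i → vertex p i ≡ v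
  vertex-index {v} p v∈ with ∈V-elim {v} p v∈
  ... | inj₁ refl = zero , refl
  ... | inj₂ (inj₁ refl) = suc zero , refl
  ... | inj₂ (inj₂ refl) = suc (suc zero) , refl

  exhausted : ∀ (p : PT) {x y z w} → x ∈V p → y ∈V p → z ∈V p → x ≢ y → x ≢ z → y ≢ z →
    w ∈V p → w ≡ x ⊎ w ≡ y ⊎ w ≡ z
  exhausted p {x} {y} {z} {w} x∈ y∈ z∈ x≢y x≢z y≢z w∈
    with vertex-index {x} p x∈ | vertex-index {y} p y∈ | vertex-index {z} p z∈ | vertex-index {w} p w∈
  ... | i , refl | j , refl | k , refl | l , refl
    with fin3-exhausted i j k l (x≢y ∘ cong (vertex p)) (x≢z ∘ cong (vertex p)) (y≢z ∘ cong (vertex p))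
  ... | inj₁ l≡i = inj₁ (cong (vertex p) l≡i)
  ... | inj₂ (inj₁ l≡j) = inj₂ (inj₁ (cong (vertex p) l≡j))
  ... | inj₂ (inj₂ l≡k) = inj₂ (inj₂ (cong (vertex p) l≡k))

  third-vertex : ∀ (p : PT) {x y z w} → x ∈V p → y ∈V p → z ∈V p → x ≢ y → x ≢ z → y ≢ z →
    w ∈V p → w ≢ x → w ≢ y → w ≡ z
  third-vertex p x∈ y∈ z∈ x≢y x≢z y≢z w∈ w≢x w≢y with exhausted p x∈ y∈ z∈ x≢y x≢z y≢z w∈
  ... | inj₁ w≡x = ⊥-elim (w≢x w≡x)
  ... | inj₂ (inj₁ w≡y) = ⊥-elim (w≢y w≡y)
  ... | inj₂ (inj₂ w≡z) = w≡z

  no-four-vertices : ∀ (p : PT) {w₁ w₂ w₃ w₄} → w₁ ∈V p → w₂ ∈V p → w₃ ∈V p → w₄ ∈V p →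
    w₁ ≢ w₂ → w₁ ≢ w₃ → w₁ ≢ w₄ → w₂ ≢ w₃ → w₂ ≢ w₄ → w₃ ≢ w₄ → ⊥
  no-four-vertices p ∈₁ ∈₂ ∈₃ ∈₄ ≢₁₂ ≢₁₃ ≢₁₄ ≢₂₃ ≢₂₄ ≢₃₄
    with exhausted p ∈₁ ∈₂ ∈₃ ≢₁₂ ≢₁₃ ≢₂₃ ∈₄
  ... | inj₁ e = ≢₁₄ (sym e)
  ... | inj₂ (inj₁ e) = ≢₂₄ (sym e)
  ... | inj₂ (inj₂ e) = ≢₃₄ (sym e)

  SameEdge : Fin n → Fin n → Fin n → Fin n → Set
  SameEdge x y u v = (x ≡ u × y ≡ v) ⊎ (x ≡ v × y ≡ u)

  sameEdge-elim : ∀ {x y u v} → sameEdge G x y u v ≡ true → SameEdge x y u v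
  sameEdge-elim {x} {y} {u} {v} e with ∨-elim {(x ≐ u) ∧ (y ≐ v)} e
  ... | inj₁ e₁ = let (x≐u , y≐v) = ∧-elim e₁ in inj₁ (≐-sound x≐u , ≐-sound y≐v)
  ... | inj₂ e₂ = let (x≐v , y≐u) = ∧-elim {x ≐ v} e₂ in inj₂ (≐-sound x≐v , ≐-sound y≐u)

  sameEdge-intro : ∀ {x y u v} → SameEdge x y u v → sameEdge G x y u v ≡ true
  sameEdge-intro {x} {y} (inj₁ (refl , refl)) =
    ∨-introˡ ((x ≐ y) ∧ (y ≐ x)) (∧-intro (≐-refl x) (≐-refl y))
  sameEdge-intro {x} {y} (inj₂ (refl , refl)) =
    ∨-introʳ ((x ≐ y) ∧ (y ≐ x)) (∧-intro (≐-refl x) (≐-refl y))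

  SameEdge-sym : ∀ {x y u v} → SameEdge x y u v → SameEdge u v x y
  SameEdge-sym (inj₁ (e₁ , e₂)) = inj₁ (sym e₁ , sym e₂)
  SameEdge-sym (inj₂ (e₁ , e₂)) = inj₂ (sym e₂ , sym e₁)

  edgeIn-elim : ∀ {x y} (q : PT) → edgeIn G x y q ≡ true → SameEdge x y (a q) (b q) ⊎ SameEdge x y (b q) (c q)
  edgeIn-elim {x} {y} q e with ∨-elim {sameEdge G x y (a q) (b q)} e
  ... | inj₁ e₁ = inj₁ (sameEdge-elim e₁)
  ... | inj₂ e₂ = inj₂ (sameEdge-elim e₂)

  edgeIn-ab : ∀ {x y} (q : PT) → SameEdge x y (a q) (b q) → edgeIn G x y q ≡ true
  edgeIn-ab q s = ∨-introˡ _ (sameEdge-intro s)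

  edgeIn-bc : ∀ {x y} (q : PT) → SameEdge x y (b q) (c q) → edgeIn G x y q ≡ true
  edgeIn-bc {x} {y} q s = ∨-introʳ (sameEdge G x y (a q) (b q)) (sameEdge-intro s)

  edge-ends : ∀ {x y} (q : PT) → edgeIn G x y q ≡ true → x ∈V q × y ∈V q
  edge-ends {x} {y} q e with edgeIn-elim {x} {y} q e
  ... | inj₁ (inj₁ (refl , refl)) = a∈V q , b∈V q
  ... | inj₁ (inj₂ (refl , refl)) = b∈V q , a∈V q
  ... | inj₂ (inj₁ (refl , refl)) = b∈V q , c∈V q
  ... | inj₂ (inj₂ (refl , refl)) = c∈V q , b∈V q

  edge-adj : ∀ {x y} (p : PT) → edgeIn G x y p ≡ true → adj G x y ≡ true
  edge-adj {x} {y} p e with edgeIn-elim {x} {y} p e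
  ... | inj₁ (inj₁ (refl , refl)) = ab p
  ... | inj₁ (inj₂ (refl , refl)) = trans (adj-sym G (b p) (a p)) (ab p)
  ... | inj₂ (inj₁ (refl , refl)) = bc p
  ... | inj₂ (inj₂ (refl , refl)) = trans (adj-sym G (c p) (b p)) (bc p)

  incident-edge : ∀ {u} (q : PT) → u ∈V q → Σ (Fin n) λ w → w ∈V q × w ≢ u × edgeIn G w u q ≡ true
  incident-edge {u} q u∈ with ∈V-elim {u} q u∈
  ... | inj₁ refl = b q , b∈V q , a≢b q ∘ sym , edgeIn-ab q (inj₂ (refl , refl))
  ... | inj₂ (inj₁ refl) = a q , a∈V q , a≢b q , edgeIn-ab q (inj₁ (refl , refl))
  ... | inj₂ (inj₂ refl) = b q , b∈V q , b≢c q , edgeIn-bc q (inj₁ (refl , refl))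

  edgesSub-vertices : ∀ (p q : PT) → edgesSub G p q ≡ true → ∀ v → v ∈V p → v ∈V q
  edgesSub-vertices p q e v v∈ with ∧-elim {edgeIn G (a p) (b p) q} e | ∈V-elim {v} p v∈
  ... | e₁ , e₂ | inj₁ refl = proj₁ (edge-ends {a p} {b p} q e₁)
  ... | e₁ , e₂ | inj₂ (inj₁ refl) = proj₁ (edge-ends {b p} {c p} q e₂)
  ... | e₁ , e₂ | inj₂ (inj₂ refl) = proj₂ (edge-ends {b p} {c p} q e₂)

  sameEdges-self : ∀ (p : PT) → sameEdges G p p ≡ 1
  sameEdges-self p rewrite ∧-intro (edgeIn-ab p (inj₁ (refl , refl))) (edgeIn-bc p (inj₁ (refl , refl))) = refl

  sameEdges≤1 : ∀ (p q : PT) → sameEdges G p q ≤ 1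
  sameEdges≤1 p q with edgesSub G p q ∧ edgesSub G q p
  ... | true = s≤s z≤n
  ... | false = z≤n

  sameEdges-vertices : ∀ (p q : PT) → 0 < sameEdges G p q → (∀ v → v ∈V p → v ∈V q) × (∀ v → v ∈V q → v ∈V p)
  sameEdges-vertices p q pos with edgesSub G p q in e₁ | edgesSub G q p in e₂
  ... | true | true = edgesSub-vertices p q e₁ , edgesSub-vertices q p e₂

  -- p' contains an edge of q: the middle vertex of q and one of its ends lie in V(p').
  edgeInside : PT → PT → Bool
  edgeInside q p' = inV G (b q) p' ∧ (inV G (a q) p' ∨ inV G (c q) p')

  edgeInside-intro : ∀ {s t} (q p' : PT) → edgeIn G s t q ≡ true → s ∈V p' → t ∈V p' → edgeInside q p' ≡ true
  edgeInside-intro {s} {t} q p' e s∈ t∈ with edgeIn-elim {s} {t} q e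
  ... | inj₁ (inj₁ (refl , refl)) = ∧-intro t∈ (∨-introˡ (inV G (c q) p') s∈)
  ... | inj₁ (inj₂ (refl , refl)) = ∧-intro s∈ (∨-introˡ (inV G (c q) p') t∈)
  ... | inj₂ (inj₁ (refl , refl)) = ∧-intro s∈ (∨-introʳ (inV G (a q) p') t∈)
  ... | inj₂ (inj₂ (refl , refl)) = ∧-intro t∈ (∨-introʳ (inV G (a q) p') s∈)

  edgeInside-elim : ∀ (q p' : PT) → edgeInside q p' ≡ true →
    b q ∈V p' × Σ (Fin n) λ y → y ∈V q × y ∈V p' × b q ≢ y
  edgeInside-elim q p' e with ∧-elim {inV G (b q) p'} e
  ... | b∈ , ac∈ with ∨-elim {inV G (a q) p'} ac∈
  ...   | inj₁ a∈ = b∈ , a q , a∈V q , a∈ , (λ e → a≢b q (sym e))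
  ...   | inj₂ c∈ = b∈ , c q , c∈V q , c∈ , b≢c q

  overlap-zero : ∀ (p' q : PT) → edgeInside q p' ≡ false → edgeOverlap G p' q ≡ 0
  overlap-zero p' q none with edgeIn G (a p') (b p') q in e₁ | edgeIn G (b p') (c p') q in e₂
  ... | false | false = refl
  ... | true | _ with () ← trans (sym (edgeInside-intro {a p'} {b p'} q p' e₁ (a∈V p') (b∈V p'))) none
  ... | false | true with () ← trans (sym (edgeInside-intro {b p'} {c p'} q p' e₂ (b∈V p') (c∈V p'))) none

  overlap-positive : ∀ (p r : PT) → edgeIn G (b r) (c r) p ≡ true → 1 ≤ edgeOverlap G p r
  overlap-positive p r e with edgeIn-elim {b r} {c r} p e
  ... | inj₁ s rewrite edgeIn-bc r (SameEdge-sym s) = s≤s z≤n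
  ... | inj₂ s rewrite edgeIn-bc r (SameEdge-sym s) = m≤n+m 1 (𝟙 (edgeIn G (a p) (b p) r))

  meets : PT → PT → Bool
  meets q p = inV G (a q) p ∨ inV G (b q) p ∨ inV G (c q) p

  meets-intro : ∀ {x} (q p : PT) → x ∈V q → x ∈V p → meets q p ≡ true
  meets-intro {x} q p x∈q x∈p with ∈V-elim {x} q x∈q
  ... | inj₁ refl = ∨-introˡ (inV G (b q) p ∨ inV G (c q) p) x∈p
  ... | inj₂ (inj₁ refl) = ∨-introʳ (inV G (a q) p) (∨-introˡ (inV G (c q) p) x∈p)
  ... | inj₂ (inj₂ refl) = ∨-introʳ (inV G (a q) p) (∨-introʳ (inV G (b q) p) x∈p)

  meets-elim : ∀ (q p : PT) → meets q p ≡ true → Σ (Fin n) λ z → z ∈V q × z ∈V p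
  meets-elim q p e with ∨-elim {inV G (a q) p} e
  ... | inj₁ e₁ = a q , a∈V q , e₁
  ... | inj₂ e₂ with ∨-elim {inV G (b q) p} e₂
  ...   | inj₁ e₃ = b q , b∈V q , e₃
  ...   | inj₂ e₄ = c q , c∈V q , e₄

  disjoint-apart : ∀ {q₁ q₂ s t} → Disjoint G q₁ q₂ → s ∈V q₁ → t ∈V q₂ → s ≢ t
  disjoint-apart {s = s} d s∈ t∈ refl = d s s∈ t∈

  equal-or-disjoint : ∀ {L x y} → IsPacking G L → x ∈ L → y ∈ L → x ≡ y ⊎ Disjoint G x y
  equal-or-disjoint (Dx ∷ pk) (here refl) (here refl) = inj₁ refl
  equal-or-disjoint (Dx ∷ pk) (here refl) (there y∈) = inj₂ (lookup Dx y∈)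
  equal-or-disjoint (Dx ∷ pk) (there x∈) (here refl) = inj₂ (λ v h₁ h₂ → lookup Dx x∈ v h₂ h₁)
  equal-or-disjoint (Dx ∷ pk) (there x∈) (there y∈) = equal-or-disjoint pk x∈ y∈

  share-vertex : ∀ {L x y v} → IsPacking G L → x ∈ L → y ∈ L → v ∈V x → v ∈V y → x ≡ y
  share-vertex {v = v} pk x∈ y∈ v∈x v∈y with equal-or-disjoint pk x∈ y∈
  ... | inj₁ e = e
  ... | inj₂ d = ⊥-elim (d v v∈x v∈y)

  ∈Vs-elim : ∀ {v} L → inVs G v L ≡ true → Σ PT λ q → q ∈ L × v ∈V q
  ∈Vs-elim (p ∷ L) e with ∨-elim e
  ... | inj₁ e₁ = p , here refl , e₁
  ... | inj₂ e₂ = let (q , q∈ , v∈) = ∈Vs-elim L e₂ in q , there q∈ , v∈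

  ∈Vs-intro : ∀ {v q L} → q ∈ L → v ∈V q → inVs G v L ≡ true
  ∈Vs-intro {L = p ∷ L} (here refl) v∈ = ∨-introˡ _ v∈
  ∈Vs-intro {v} {L = p ∷ L} (there q∈) v∈ = ∨-introʳ (inV G v p) (∈Vs-intro q∈ v∈)

  disjoint-from-others : ∀ L R q → IsPacking G (L ++ q ∷ R) → ∀ {y} → y ∈ L ++ R → Disjoint G q y
  disjoint-from-others [] R q (Dq ∷ pk) y∈ = lookup Dq y∈
  disjoint-from-others (x ∷ L) R q (Dx ∷ pk) (here refl) =
    λ v h₁ h₂ → lookup Dx (∈-++⁺ʳ L (here refl)) v h₂ h₁
  disjoint-from-others (x ∷ L) R q (Dx ∷ pk) (there y∈) = disjoint-from-others L R q pk y∈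

  replace-packing : ∀ L R q r → IsPacking G (L ++ q ∷ R) → (∀ {y} → y ∈ L ++ R → Disjoint G r y) →
    IsPacking G (L ++ r ∷ R)
  replace-packing [] R q r (Dq ∷ pk) avoids = tabulate avoids ∷ pk
  replace-packing (x ∷ L) R q r (Dx ∷ pk) avoids =
    tabulate Dx′ ∷ replace-packing L R q r pk (avoids ∘ there)
    where
    Dx′ : ∀ {y} → y ∈ L ++ r ∷ R → Disjoint G x y
    Dx′ y∈ with ∈-replaced L R r y∈
    ... | inj₁ refl = λ v h₁ h₂ → avoids (here refl) v h₂ h₁
    ... | inj₂ y∈′ = lookup Dx (∈-inserted L R q y∈′)

  doubleSum-replaced : ∀ (h : PT → PT → ℕ) (P : List PT) L R q r →
    doubleSum G h P (L ++ r ∷ R) + Σ[ P ] (λ p → h p q) ≡ doubleSum G h P (L ++ q ∷ R) + Σ[ P ] (λ p → h p r)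
  doubleSum-replaced h P L R q r = begin
      doubleSum G h P (L ++ r ∷ R) + Σ[ P ] (λ p → h p q)
    ≡⟨ sym (sum-+ P (λ p → Σ[ L ++ r ∷ R ] (h p)) (λ p → h p q)) ⟩
      Σ[ P ] (λ p → Σ[ L ++ r ∷ R ] (h p) + h p q)
    ≡⟨ sum-cong P (λ {p} _ → sum-replaced L R q r (h p)) ⟩
      Σ[ P ] (λ p → Σ[ L ++ q ∷ R ] (h p) + h p r)
    ≡⟨ sum-+ P (λ p → Σ[ L ++ q ∷ R ] (h p)) (λ p → h p r) ⟩
      doubleSum G h P (L ++ q ∷ R) + Σ[ P ] (λ p → h p r)
    ∎
    where open ≡-Reasoning

  ∈V-apart : ∀ {p' t z} → t ∈V p' → ¬ z ∈V p' → t ≢ z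
  ∈V-apart {p'} t∈ z∉ e = z∉ (subst (_∈V p') e t∈)

  count-point : ∀ (g : Fin n → Bool) x → 𝟙 (g x) ≤ countB (λ v → (v ≐ x) ∧ g v) (allFin n)
  count-point g x with g x in gx
  ... | true = countB-witness (allFin n) (λ v → (v ≐ x) ∧ g v) (∈-allFin x) (∧-intro (≐-refl x) gx)
  ... | false = z≤n

  count-path : ∀ (p : PT) (g : Fin n → Bool) →
    𝟙 (g (a p)) + 𝟙 (g (b p)) + 𝟙 (g (c p)) ≤ countB (λ v → inV G v p ∧ g v) (allFin n)
  count-path p g = begin
      𝟙 (g (a p)) + 𝟙 (g (b p)) + 𝟙 (g (c p))
    ≡⟨ +-assoc (𝟙 (g (a p))) _ _ ⟩
      𝟙 (g (a p)) + (𝟙 (g (b p)) + 𝟙 (g (c p)))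
    ≤⟨ +-mono-≤ (count-point g (a p)) (+-mono-≤ (count-point g (b p)) (count-point g (c p))) ⟩
      countB (at (a p)) (allFin n) + (countB (at (b p)) (allFin n) + countB (at (c p)) (allFin n))
    ≤⟨ +-monoʳ-≤ (countB (at (a p)) (allFin n)) (countB-disjoint (allFin n) _ _ at-bc b-or-c-disjoint
                   (λ v → ∧-weakenˡ (v ≐ b p) (v ≐ c p)) (λ v → ∧-weakenʳ (v ≐ b p) (v ≐ c p))) ⟩
      countB (at (a p)) (allFin n) + countB at-bc (allFin n)
    ≤⟨ countB-disjoint (allFin n) _ _ _ a-or-bc-disjoint
         (λ v → ∧-weakenˡ (v ≐ a p) ((v ≐ b p) ∨ (v ≐ c p)))
         (λ v → ∧-weakenʳ (v ≐ a p) ((v ≐ b p) ∨ (v ≐ c p))) ⟩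
      countB (λ v → inV G v p ∧ g v) (allFin n)
    ∎
    where
    open ≤-Reasoning
    at : Fin n → Fin n → Bool
    at x v = (v ≐ x) ∧ g v
    at-bc : Fin n → Bool
    at-bc v = ((v ≐ b p) ∨ (v ≐ c p)) ∧ g v
    b-or-c-disjoint : ∀ v → at (b p) v ≡ true → at (c p) v ≡ true → ⊥
    b-or-c-disjoint v e₁ e₂ =
      b≢c p (trans (sym (≐-sound {v} {b p} (proj₁ (∧-elim {v ≐ b p} e₁)))) (≐-sound {v} {c p} (proj₁ (∧-elim {v ≐ c p} e₂))))
    a-or-bc-disjoint : ∀ v → at (a p) v ≡ true → at-bc v ≡ true → ⊥
    a-or-bc-disjoint v e₁ e₂ with ∨-elim {v ≐ b p} (proj₁ (∧-elim {(v ≐ b p) ∨ (v ≐ c p)} e₂))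
    ... | inj₁ v≐b = a≢b p (trans (sym v≡a) (≐-sound {v} {b p} v≐b))
      where v≡a = ≐-sound {v} {a p} (proj₁ (∧-elim {v ≐ a p} e₁))
    ... | inj₂ v≐c = a≢c p (trans (sym v≡a) (≐-sound {v} {c p} v≐c))
      where v≡a = ≐-sound {v} {a p} (proj₁ (∧-elim {v ≐ a p} e₁))

  count-packing : ∀ (L : List PT) → IsPacking G L → (g : Fin n → Bool) →
    Σ[ L ] (λ p → 𝟙 (g (a p)) + 𝟙 (g (b p)) + 𝟙 (g (c p))) ≤ countB (λ v → inVs G v L ∧ g v) (allFin n)
  count-packing [] pk g = z≤n
  count-packing (p ∷ L) (Dp ∷ pk) g = ≤-trans (+-mono-≤ (count-path p g) (count-packing L pk g))
    (countB-disjoint (allFin n) (λ v → inV G v p ∧ g v) (λ v → inVs G v L ∧ g v) _ disjoint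
      (λ v → ∧-weakenˡ (inV G v p) (inVs G v L)) (λ v → ∧-weakenʳ (inV G v p) (inVs G v L)))
    where
    disjoint : ∀ v → inV G v p ∧ g v ≡ true → inVs G v L ∧ g v ≡ true → ⊥
    disjoint v e₁ e₂ =
      let (q , q∈ , v∈q) = ∈Vs-elim L (proj₁ (∧-elim {inVs G v L} e₂)) in
      lookup Dp q∈ v (proj₁ (∧-elim {inV G v p} e₁)) v∈q

module Exchange {n : ℕ} (G : Graph n) (P Q : List (P2 G)) (j : ℕ)
  (P-packing : IsPacking G P) (P-size : length P ≡ j) (Q-optimal : InQ2 G P j Q) where
  open Paths G

  Q-packing : IsPacking G Q
  Q-packing = proj₁ (proj₁ Q-optimal)

  Q-size : length Q ≡ suc j
  Q-size = proj₁ (proj₂ (proj₁ Q-optimal))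

  covered : Fin n → Bool
  covered v = inVs G v Q

  uncovered-avoids : ∀ {u q} → covered u ≡ false → q ∈ Q → ¬ u ∈V q
  uncovered-avoids unc q∈ u∈ with () ← trans (sym (∈Vs-intro q∈ u∈)) unc

  col₁ col₂ : PT → ℕ
  col₁ q = Σ[ P ] (λ p → sameEdges G p q)
  col₂ q = Σ[ P ] (λ p → edgeOverlap G p q)

  record Swappable (q r : PT) : Set where
    constructor swappable
    field
      member : q ∈ Q
      avoids : ∀ {y} → y ∈ Q → Disjoint G q y → Disjoint G r y

  swapped : ∀ {q r} → Swappable q r → Σ (List PT) λ Q' → IsPacking G Q' × length Q' ≡ suc j ×
    (∀ h → doubleSum G h P Q' + Σ[ P ] (λ p → h p q) ≡ doubleSum G h P Q + Σ[ P ] (λ p → h p r))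
  swapped {q} {r} (swappable q∈Q avoids) with ∈-∃++ q∈Q
  ... | L , R , Q≡ = L ++ r ∷ R , packing , size , change
    where
    split-packing : IsPacking G (L ++ q ∷ R)
    split-packing = subst (IsPacking G) Q≡ Q-packing
    packing : IsPacking G (L ++ r ∷ R)
    packing = replace-packing L R q r split-packing λ y∈ →
      avoids (subst (_ ∈_) (sym Q≡) (∈-inserted L R q y∈)) (disjoint-from-others L R q split-packing y∈)
    size : length (L ++ r ∷ R) ≡ suc j
    size = trans (length-replaced L R q r) (trans (cong length (sym Q≡)) Q-size)
    change : ∀ h → doubleSum G h P (L ++ r ∷ R) + Σ[ P ] (λ p → h p q) ≡ doubleSum G h P Q + Σ[ P ] (λ p → h p r)
    change h = subst (λ Q₀ → doubleSum G h P (L ++ r ∷ R) + _ ≡ doubleSum G h P Q₀ + _) (sym Q≡)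
                     (doubleSum-replaced h P L R q r)

  swap₁ : ∀ {q r} → Swappable q r → col₁ r ≤ col₁ q
  swap₁ s with swapped s
  ... | Q' , packing , size , change = trade (change (sameEdges G)) (proj₂ (proj₂ (proj₁ Q-optimal)) Q' packing size)

  swap₂ : ∀ {q r} → Swappable q r → col₁ q ≤ col₁ r → col₂ r ≤ col₂ q
  swap₂ s col₁-kept with swapped s
  ... | Q' , packing , size , change = trade (change (edgeOverlap G)) (proj₂ Q-optimal Q' Q'∈𝔔₁)
    where
    Q'∈𝔔₁ : InQ1 G P j Q'
    Q'∈𝔔₁ = packing , size , λ Q'' pk'' size'' →
      ≤-trans (proj₂ (proj₂ (proj₁ Q-optimal)) Q'' pk'' size'') (trade′ (change (sameEdges G)) col₁-kept)

  self-column : ∀ {p} → p ∈ P → 1 ≤ col₁ p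
  self-column {p} p∈ = subst (_≤ col₁ p) (sameEdges-self p) (term≤sum (λ p'' → sameEdges G p'' p) p∈)

  row₁≤1 : ∀ p → Σ[ Q ] (sameEdges G p) ≤ 1
  row₁≤1 p = at-most-one (sameEdges G p) Q-packing (sameEdges≤1 p)
    λ {x} {y} _ _ p≡x p≡y disj →
      disj (a p) (proj₁ (sameEdges-vertices p x p≡x) (a p) (a∈V p)) (proj₁ (sameEdges-vertices p y p≡y) (a p) (a∈V p))

  -- Σ_q col₁ q ≤ |𝒫| < |𝒬|, so some member of 𝒬 has an empty first column.
  empty-column : Σ PT λ q → q ∈ Q × col₁ q ≡ 0
  empty-column = vanishing-term Q col₁ (begin-strict
      Σ[ Q ] col₁                              ≡⟨ sym (sum-swap P Q (sameEdges G)) ⟩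
      Σ[ P ] (λ p → Σ[ Q ] (sameEdges G p))    ≤⟨ sum-mono P (λ {p} _ → row₁≤1 p) ⟩
      Σ[ P ] (λ _ → 1)                         ≡⟨ trans (sum-const P 1) (*-identityˡ (length P)) ⟩
      length P                                 ≡⟨ P-size ⟩
      j                                        <⟨ n<1+n j ⟩
      suc j                                    ≡⟨ sym Q-size ⟩
      length Q                                 ∎)
    where open ≤-Reasoning

  -- If p ∈ 𝒫 has an uncovered vertex and shares a vertex with q ∈ 𝒬, then col₁ q = 0: a
  -- p'' ∈ 𝒫 with E(p'') = E(q) would meet p, hence be p, yet lie inside V(𝒬).
  untouched-column : ∀ {p q u x} → p ∈ P → u ∈V p → covered u ≡ false → x ∈V p → q ∈ Q → x ∈V q →
    col₁ q ≡ 0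
  untouched-column {p} {q} {u} {x} p∈ u∈p unc x∈p q∈ x∈q =
    sum-zero P λ p''∈ → n≤0⇒n≡0 (≮⇒≥ (no-copy p''∈))
    where
    no-copy : ∀ {p''} → p'' ∈ P → ¬ 0 < sameEdges G p'' q
    no-copy {p''} p''∈ copy with sameEdges-vertices p'' q copy | equal-or-disjoint P-packing p''∈ p∈
    ... | p''⊆q , _ | inj₁ refl = uncovered-avoids unc q∈ (p''⊆q u u∈p)
    ... | _ , q⊆p'' | inj₂ disj = disj x (q⊆p'' x x∈q) x∈p

  -- Swapping p ∈ 𝒫 in for a q ∈ 𝒬 with empty first column that holds all covered
  -- vertices of p would raise score₁.
  absorb : ∀ {p q} → p ∈ P → q ∈ Q → col₁ q ≡ 0 → (∀ v → v ∈V p → covered v ≡ true → v ∈V q) → ⊥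
  absorb {p} {q} p∈ q∈ empty inside =
    <⇒≱ (subst (_< col₁ p) (sym empty) (self-column p∈)) (swap₁ {q} {p} (swappable q∈ avoids))
    where
    avoids : ∀ {y} → y ∈ Q → Disjoint G q y → Disjoint G p y
    avoids y∈ disj v v∈p v∈y = disj v (inside v v∈p (∈Vs-intro {v} y∈ v∈y)) v∈y

  covered-vertex : ∀ {p} → p ∈ P → Σ (Fin n) λ x → x ∈V p × covered x ≡ true
  covered-vertex {p} p∈ with covered (a p) in ca | covered (b p) in cb | covered (c p) in cc
  ... | true  | _     | _     = a p , a∈V p , ca
  ... | false | true  | _     = b p , b∈V p , cb
  ... | false | false | true  = c p , c∈V p , cc
  ... | false | false | false with empty-column
  ...   | q , q∈ , empty = ⊥-elim (absorb p∈ q∈ empty none-covered)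
    where
    none-covered : ∀ v → v ∈V p → covered v ≡ true → v ∈V q
    none-covered v v∈ cv with ∈V-elim {v} p v∈
    ... | inj₁ refl with () ← trans (sym cv) ca
    ... | inj₂ (inj₁ refl) with () ← trans (sym cv) cb
    ... | inj₂ (inj₂ refl) with () ← trans (sym cv) cc

  scattered : ∀ {p q u x} → p ∈ P → u ∈V p → covered u ≡ false → q ∈ Q → x ∈V p → x ∈V q →
    ¬ (∀ v → v ∈V p → covered v ≡ true → v ∈V q)
  scattered {p} {q} {u} {x} p∈ u∈ unc q∈ x∈p x∈q = absorb p∈ q∈ (untouched-column {p} {q} {u} {x} p∈ u∈ unc x∈p q∈ x∈q)

  one-uncovered : ∀ {p u v} → p ∈ P → u ∈V p → v ∈V p → u ≢ v → covered u ≡ false → covered v ≡ false → ⊥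
  one-uncovered {p} {u} {v} p∈ u∈ v∈ u≢v u-unc v-unc with covered-vertex p∈
  ... | x , x∈ , x-cov with ∈Vs-elim Q x-cov
  ...   | q , q∈ , x∈q = scattered {p} {q} {u} {x} p∈ u∈ u-unc q∈ x∈ x∈q inside
    where
    inside : ∀ w → w ∈V p → covered w ≡ true → w ∈V q
    inside w w∈ w-cov = subst (_∈V q) (sym (third-vertex p u∈ v∈ x∈ u≢v
      (≢-sym (apart covered x-cov u-unc)) (≢-sym (apart covered x-cov v-unc))
      w∈ (apart covered w-cov u-unc) (apart covered w-cov v-unc))) x∈q

  no-shared-pair : ∀ {p u q y₁ y₂} → p ∈ P → u ∈V p → covered u ≡ false → q ∈ Q →
    y₁ ∈V p → y₁ ∈V q → y₂ ∈V p → y₂ ∈V q → y₁ ≢ y₂ → ⊥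
  no-shared-pair {p} {u} {q} {y₁} {y₂} p∈ u∈ unc q∈ y₁∈p y₁∈q y₂∈p y₂∈q y₁≢y₂ =
    scattered {p} {q} {u} {y₁} p∈ u∈ unc q∈ y₁∈p y₁∈q inside
    where
    inside : ∀ w → w ∈V p → covered w ≡ true → w ∈V q
    inside w w∈ w-cov with exhausted p u∈ y₁∈p y₂∈p
      (≢-sym (apart covered (∈Vs-intro {y₁} q∈ y₁∈q) unc)) (≢-sym (apart covered (∈Vs-intro {y₂} q∈ y₂∈q) unc)) y₁≢y₂ w∈
    ... | inj₁ w≡u = ⊥-elim (apart covered w-cov unc w≡u)
    ... | inj₂ (inj₁ refl) = y₁∈q
    ... | inj₂ (inj₂ refl) = y₂∈q

  -- Otherwise col₂ q = 0 = col₁ q, and replacing q by the path w–x–u (w a neighbour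
  -- of x on q) would raise score₂ while keeping score₁.
  edge-witness : ∀ {p q u x} → p ∈ P → covered u ≡ false → edgeIn G x u p ≡ true → q ∈ Q → x ∈V q →
    Σ PT λ p' → p' ∈ P × edgeInside q p' ≡ true
  edge-witness {p} {q} {u} {x} p∈ unc xu∈p q∈ x∈q
    with any? (λ p' → edgeInside q p' Bool.≟ true) P | incident-edge {x} q x∈q
  ... | yes found | _ = find found
  ... | no ¬found | w , w∈q , _ , wx∈q =
    ⊥-elim (<⇒≱ gain (swap₂ {q} {r} (swappable q∈ avoids) (subst (_≤ col₁ r) (sym col₁-zero) z≤n)))
    where
    r : PT
    r = path w x u (edge-adj {w} {x} q wx∈q) (edge-adj {x} {u} p xu∈p) (apart covered (∈Vs-intro {w} q∈ w∈q) unc)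
    col₁-zero : col₁ q ≡ 0
    col₁-zero = untouched-column {p} {q} {u} {x} p∈ (proj₂ (edge-ends {x} {u} p xu∈p)) unc (proj₁ (edge-ends {x} {u} p xu∈p)) q∈ x∈q
    col₂-zero : col₂ q ≡ 0
    col₂-zero = sum-zero P λ {p''} p''∈ → overlap-zero p'' q (Bool.¬-not (lookup (¬Any⇒All¬ P ¬found) p''∈))
    gain : col₂ q < col₂ r
    gain = subst (_< col₂ r) (sym col₂-zero)
      (≤-trans (overlap-positive p r xu∈p) (term≤sum (λ p'' → edgeOverlap G p'' r) p∈))
    avoids : ∀ {y} → y ∈ Q → Disjoint G q y → Disjoint G r y
    avoids y∈ disj v v∈r v∈y with ∈V-elim {v} r v∈r
    ... | inj₁ refl = disj v w∈q v∈y
    ... | inj₂ (inj₁ refl) = disj v x∈q v∈y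
    ... | inj₂ (inj₂ refl) = uncovered-avoids unc y∈ v∈y

  bad : PT → Bool
  bad p = not (covered (a p) ∧ covered (b p) ∧ covered (c p))

  covered-count : PT → ℕ
  covered-count p = 𝟙 (covered (a p)) + 𝟙 (covered (b p)) + 𝟙 (covered (c p))

  three-covered : ∀ {p} → p ∈ P → 3 ≤ covered-count p + 𝟙 (bad p)
  three-covered {p} p∈ with covered (a p) in ca | covered (b p) in cb | covered (c p) in cc
  ... | true  | true  | true  = ≤-refl
  ... | true  | true  | false = ≤-refl
  ... | true  | false | true  = ≤-refl
  ... | false | true  | true  = ≤-refl
  ... | true  | false | false = ⊥-elim (one-uncovered p∈ (b∈V p) (c∈V p) (b≢c p) cb cc)
  ... | false | true  | false = ⊥-elim (one-uncovered p∈ (a∈V p) (c∈V p) (a≢c p) ca cc)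
  ... | false | false | _     = ⊥-elim (one-uncovered p∈ (a∈V p) (b∈V p) (a≢b p) ca cb)

  bad-elim : ∀ p → bad p ≡ true → Σ (Fin n) λ u → u ∈V p × covered u ≡ false
  bad-elim p bad-p with covered (a p) in ca | covered (b p) in cb | covered (c p) in cc
  ... | false | _     | _     = a p , a∈V p , ca
  ... | true  | false | _     = b p , b∈V p , cb
  ... | true  | true  | false = c p , c∈V p , cc
  ... | true  | true  | true  with () ← bad-p

  linked : PT → PT → Bool
  linked p p' = bad p ∧ any (λ q → meets q p ∧ edgeInside q p') Q

  linked-elim : ∀ p p' → linked p p' ≡ true →
    bad p ≡ true × Σ PT λ q → q ∈ Q × meets q p ≡ true × edgeInside q p' ≡ true
  linked-elim p p' e with ∧-elim {bad p} e
  ... | bad-p , some with any-elim (λ q → meets q p ∧ edgeInside q p') Q some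
  ...   | q , q∈ , both = bad-p , q , q∈ , ∧-elim {meets q p} both

  -- Every bad p ∈ 𝒫 is linked to some p' ∈ 𝒫: an edge xu of p with u uncovered has x
  -- covered, and `edge-witness` applies to the q ∈ 𝒬 through x.
  bad-is-linked : ∀ {p} → p ∈ P → 𝟙 (bad p) ≤ Σ[ P ] (λ p' → 𝟙 (linked p p'))
  bad-is-linked {p} p∈ = 𝟙-≤ (bad p) link-exists
    where
    link-exists : bad p ≡ true → 1 ≤ Σ[ P ] (λ p' → 𝟙 (linked p p'))
    link-exists bad-p with bad-elim p bad-p
    ... | u , u∈ , unc with incident-edge {u} p u∈
    ...   | x , x∈ , x≢u , xu∈p with covered x in cx
    ...     | false = ⊥-elim (one-uncovered p∈ x∈ u∈ x≢u cx unc)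
    ...     | true with ∈Vs-elim Q cx
    ...       | q , q∈ , x∈q with edge-witness {p} {q} {u} {x} p∈ unc xu∈p q∈ x∈q
    ...         | p' , p'∈ , inside = ≤-trans (𝟙-true link) (term≤sum (λ p' → 𝟙 (linked p p')) p'∈)
      where
      link : linked p p' ≡ true
      link = ∧-intro bad-p (any-intro (λ q → meets q p ∧ edgeInside q p') Q q∈
                                      (∧-intro (meets-intro {x} q p x∈q x∈) inside))

  -- Nothing is linked to a bad p': both vertices of the edge of q inside p' would lie on q.
  no-link-to-bad : ∀ {p p'} → p' ∈ P → bad p' ≡ true → linked p p' ≡ false
  no-link-to-bad {p} {p'} p'∈ bad-p' with linked p p' in link
  ... | false = refl
  ... | true with linked-elim p p' link | bad-elim p' bad-p'
  ...   | _ , q , q∈ , _ , inside | u , u∈ , unc with edgeInside-elim q p' inside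
  ...     | b∈ , y , y∈q , y∈p' , b≢y =
    ⊥-elim (no-shared-pair {p'} {u} {q} {b q} {y} p'∈ u∈ unc q∈ b∈ (b∈V q) y∈p' y∈q b≢y)

  bad-good-apart : ∀ {p p' z} → p ∈ P → p' ∈ P → bad p ≡ true → bad p' ≡ false → z ∈V p → ¬ z ∈V p'
  bad-good-apart {z = z} p∈ p'∈ bad-p good-p' z∈p z∈p' with share-vertex {v = z} P-packing p∈ p'∈ z∈p z∈p'
  ... | refl with () ← trans (sym bad-p) good-p'

  -- Via distinct q₁, q₂ ∈ 𝒬, p' would contain two vertices of each; via one q, the vertices
  -- where q meets p₁ and p₂ both avoid p', hence are the single vertex of q outside p'.
  unique-link : ∀ {p' p₁ p₂} → p' ∈ P → bad p' ≡ false → p₁ ∈ P → p₂ ∈ P →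
    linked p₁ p' ≡ true → linked p₂ p' ≡ true → Disjoint G p₁ p₂ → ⊥
  unique-link {p'} {p₁} {p₂} p'∈ good p₁∈ p₂∈ link₁ link₂ disj
    with linked-elim p₁ p' link₁ | linked-elim p₂ p' link₂
  ... | bad₁ , q₁ , q₁∈ , meets₁ , inside₁ | bad₂ , q₂ , q₂∈ , meets₂ , inside₂
    with edgeInside-elim q₁ p' inside₁ | edgeInside-elim q₂ p' inside₂ | equal-or-disjoint Q-packing q₁∈ q₂∈
  ... | b₁∈ , y₁ , y₁∈q₁ , y₁∈p' , b₁≢y₁ | b₂∈ , y₂ , y₂∈q₂ , y₂∈p' , b₂≢y₂ | inj₂ q-disj =
    no-four-vertices p' b₁∈ y₁∈p' b₂∈ y₂∈p' b₁≢y₁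
      (disjoint-apart {q₁} {q₂} q-disj (b∈V q₁) (b∈V q₂)) (disjoint-apart {q₁} {q₂} q-disj (b∈V q₁) y₂∈q₂)
      (disjoint-apart {q₁} {q₂} q-disj y₁∈q₁ (b∈V q₂)) (disjoint-apart {q₁} {q₂} q-disj y₁∈q₁ y₂∈q₂) b₂≢y₂
  ... | b∈ , y , y∈q , y∈p' , b≢y | _ | inj₁ refl
    with meets-elim q₁ p₁ meets₁ | meets-elim q₁ p₂ meets₂
  ...   | z₁ , z₁∈q , z₁∈p₁ | z₂ , z₂∈q , z₂∈p₂ = disj z₁ z₁∈p₁ (subst (_∈V p₂) z₂≡z₁ z₂∈p₂)
    where
    z₁∉p' : ¬ z₁ ∈V p'
    z₁∉p' = bad-good-apart {p₁} {p'} {z₁} p₁∈ p'∈ bad₁ good z₁∈p₁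
    z₂∉p' : ¬ z₂ ∈V p'
    z₂∉p' = bad-good-apart {p₂} {p'} {z₂} p₂∈ p'∈ bad₂ good z₂∈p₂
    z₂≡z₁ : z₂ ≡ z₁
    z₂≡z₁ = third-vertex q₁ (b∈V q₁) y∈q z₁∈q b≢y
      (∈V-apart {p'} b∈ z₁∉p') (∈V-apart {p'} y∈p' z₁∉p') z₂∈q
      (≢-sym (∈V-apart {p'} b∈ z₂∉p')) (≢-sym (∈V-apart {p'} y∈p' z₂∉p'))

  links-to : ∀ {p'} → p' ∈ P → Σ[ P ] (λ p → 𝟙 (linked p p')) ≤ 𝟙 (not (bad p'))
  links-to {p'} p'∈ with bad p' in bad-p'
  ... | true = ≤-reflexive (sum-zero P λ {p} _ → cong 𝟙 (no-link-to-bad {p} {p'} p'∈ bad-p'))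
  ... | false = at-most-one (λ p → 𝟙 (linked p p')) P-packing (λ p → 𝟙≤1 (linked p p'))
    λ {p₁} {p₂} p₁∈ p₂∈ pos₁ pos₂ →
      unique-link p'∈ bad-p' p₁∈ p₂∈ (𝟙-positive (linked p₁ p') pos₁) (𝟙-positive (linked p₂ p') pos₂)

  #bad #good #covered : ℕ
  #bad = Σ[ P ] (λ p → 𝟙 (bad p))
  #good = Σ[ P ] (λ p → 𝟙 (not (bad p)))
  #covered = Σ[ P ] covered-count

  -- Double counting the links: each bad member sends one, each good member receives at most one.
  bad≤good : #bad ≤ #good
  bad≤good = begin
      #bad                                              ≤⟨ sum-mono P bad-is-linked ⟩
      Σ[ P ] (λ p → Σ[ P ] (λ p' → 𝟙 (linked p p')))   ≡⟨ sum-swap P P (λ p p' → 𝟙 (linked p p')) ⟩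
      Σ[ P ] (λ p' → Σ[ P ] (λ p → 𝟙 (linked p p')))   ≤⟨ sum-mono P links-to ⟩
      #good                                             ∎
    where open ≤-Reasoning

  bad+good : #bad + #good ≡ j
  bad+good = begin
      #bad + #good                            ≡⟨ sum-+ P (λ p → 𝟙 (bad p)) (λ p → 𝟙 (not (bad p))) ⟨
      Σ[ P ] (λ p → 𝟙 (bad p) + 𝟙 (not (bad p)))  ≡⟨ sum-cong P (λ {p} _ → 𝟙-not (bad p)) ⟩
      Σ[ P ] (λ _ → 1)                        ≡⟨ sum-const P 1 ⟩
      1 * length P                            ≡⟨ *-identityˡ (length P) ⟩
      length P                                ≡⟨ P-size ⟩
      j                                       ∎
    where open ≡-Reasoning

  twice-bad≤j : 2 * #bad ≤ j
  twice-bad≤j = begin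
      2 * #bad             ≡⟨ cong (#bad +_) (+-identityʳ #bad) ⟩
      #bad + #bad          ≤⟨ +-monoʳ-≤ #bad bad≤good ⟩
      #bad + #good         ≡⟨ bad+good ⟩
      j                    ∎
    where open ≤-Reasoning

  thrice-j≤ : 3 * j ≤ #covered + #bad
  thrice-j≤ = begin
      3 * j                                     ≡⟨ cong (3 *_) P-size ⟨
      3 * length P                              ≡⟨ sum-const P 3 ⟨
      Σ[ P ] (λ _ → 3)                          ≤⟨ sum-mono P three-covered ⟩
      Σ[ P ] (λ p → covered-count p + 𝟙 (bad p)) ≡⟨ sum-+ P covered-count (λ p → 𝟙 (bad p)) ⟩
      #covered + #bad                           ∎
    where open ≤-Reasoning

  -- Distinct members of 𝒫 have distinct vertices, so covered vertices lie in V(𝒫) ∩ V(𝒬).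
  covered≤common : #covered ≤ commonVertices G P Q
  covered≤common = count-packing P P-packing covered

  bound : 5 * j ≤ 2 * commonVertices G P Q
  bound = ≤-trans (five-halves {j} {#covered} {#bad} thrice-j≤ twice-bad≤j) (*-monoʳ-≤ 2 covered≤common)

-- Finitely many P₂-families represent all of them, as far as packings and scores can tell.

module Enumeration {n : ℕ} (G : Graph n) where
  open Paths G

  -- Same vertex triple: the two P₂'s differ at most in the proofs they carry.
  _≈_ : PT → PT → Set
  p ≈ q = a p ≡ a q × b p ≡ b q × c p ≡ c q

  inV-≈ : ∀ v {p q} → p ≈ q → inV G v p ≡ inV G v q
  inV-≈ v {path _ _ _ _ _ _} {path _ _ _ _ _ _} (refl , refl , refl) = refl

  sameEdges-≈ : ∀ s {q q'} → q ≈ q' → sameEdges G s q ≡ sameEdges G s q'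
  sameEdges-≈ s {path _ _ _ _ _ _} {path _ _ _ _ _ _} (refl , refl , refl) = refl

  edgeOverlap-≈ : ∀ s {q q'} → q ≈ q' → edgeOverlap G s q ≡ edgeOverlap G s q'
  edgeOverlap-≈ s {path _ _ _ _ _ _} {path _ _ _ _ _ _} (refl , refl , refl) = refl

  disjoint-≈ : ∀ {p p' q q'} → p ≈ p' → q ≈ q' → Disjoint G p q → Disjoint G p' q'
  disjoint-≈ {p} {p'} {q} {q'} p≈ q≈ disj v v∈p' v∈q' =
    disj v (trans (inV-≈ v {p} {p'} p≈) v∈p') (trans (inV-≈ v {q} {q'} q≈) v∈q')

  packing-≈ : ∀ {xs ys} → Pointwise _≈_ xs ys → IsPacking G xs → IsPacking G ys
  packing-≈ [] [] = []
  packing-≈ (_∷_ {x} {y} x≈y xs≈ys) (Dx ∷ pk) = avoid xs≈ys Dx ∷ packing-≈ xs≈ys pk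
    where
    avoid : ∀ {us vs} → Pointwise _≈_ us vs → All (Disjoint G x) us → All (Disjoint G y) vs
    avoid [] [] = []
    avoid (_∷_ {u} {v} u≈v us≈vs) (Du ∷ Ds) = disjoint-≈ {x} {y} {u} {v} x≈y u≈v Du ∷ avoid us≈vs Ds

  doubleSum-≈ : ∀ (h : PT → PT → ℕ) → (∀ s {q q'} → q ≈ q' → h s q ≡ h s q') →
    ∀ P {xs ys} → Pointwise _≈_ xs ys → doubleSum G h P xs ≡ doubleSum G h P ys
  doubleSum-≈ h h-≈ P xs≈ys = sum-cong P λ {s} _ → row s xs≈ys
    where
    row : ∀ s {xs ys} → Pointwise _≈_ xs ys → Σ[ xs ] (h s) ≡ Σ[ ys ] (h s)
    row s [] = refl
    row s (q≈ ∷ qs≈) = cong₂ _+_ (h-≈ s q≈) (row s qs≈)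

  disjoint? : ∀ p q → Dec (Disjoint G p q)
  disjoint? p q = all? λ v → avoid? (inV G v p) (inV G v q)
    where
    avoid? : ∀ x y → Dec (x ≡ true → y ≡ true → ⊥)
    avoid? true true = no λ f → f refl refl
    avoid? true false = yes λ _ ()
    avoid? false _ = yes λ ()

  paths-on : Fin n → Fin n → Fin n → List PT
  paths-on x y z with adj G x y Bool.≟ true | adj G y z Bool.≟ true | x ≟ z
  ... | yes xy | yes yz | no x≢z = path x y z xy yz x≢z ∷ []
  ... | _      | _      | _      = []

  paths-on-complete : ∀ p → Σ PT λ p' → p' ∈ paths-on (a p) (b p) (c p) × p ≈ p'
  paths-on-complete p with adj G (a p) (b p) Bool.≟ true | adj G (b p) (c p) Bool.≟ true | a p ≟ c p
  ... | yes _ | yes _ | no _      = _ , here refl , refl , refl , refl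
  ... | yes _ | yes _ | yes a≡c   = ⊥-elim (a≢c p a≡c)
  ... | no ¬ab | _    | _         = ⊥-elim (¬ab (ab p))
  ... | yes _ | no ¬bc | _        = ⊥-elim (¬bc (bc p))

  all-paths : List PT
  all-paths = concatMap (λ x → concatMap (λ y → concatMap (paths-on x y) (allFin n)) (allFin n)) (allFin n)

  all-paths-complete : ∀ p → Σ PT λ p' → p' ∈ all-paths × p ≈ p'
  all-paths-complete p with paths-on-complete p
  ... | p' , p'∈ , p≈p' = p' , ∈-concatMap⁺ _ (lose (∈-allFin (a p))
                                 (∈-concatMap⁺ _ (lose (∈-allFin (b p))
                                   (∈-concatMap⁺ _ (lose (∈-allFin (c p)) p'∈))))) , p≈p'

  lists-of-length : ℕ → List (List PT)
  lists-of-length zero = [] ∷ []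
  lists-of-length (suc k) = cartesianProductWith _∷_ all-paths (lists-of-length k)

  lists-complete : ∀ Q → Σ (List PT) λ Q' → Q' ∈ lists-of-length (length Q) × Pointwise _≈_ Q Q'
  lists-complete [] = [] , here refl , []
  lists-complete (p ∷ Q) with all-paths-complete p | lists-complete Q
  ... | p' , p'∈ , p≈p' | Q' , Q'∈ , Q≈Q' = p' ∷ Q' , ∈-cartesianProductWith⁺ _∷_ p'∈ Q'∈ , p≈p' ∷ Q≈Q'

module Optimum {n : ℕ} (G : Graph n) (P : List (P2 G)) (j : ℕ) where
  open Paths G
  open Enumeration G

  Feasible : List PT → Set
  Feasible Q = IsPacking G Q × length Q ≡ suc j

  feasible? : ∀ Q → Dec (Feasible Q)
  feasible? Q = allPairs? disjoint? Q ×-dec (length Q ℕ.≟ suc j)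

  candidates : List (List PT)
  candidates = lists-of-length (suc j)

  representative : ∀ {Q} → Feasible Q → Σ (List PT) λ Q' → Q' ∈ candidates × Feasible Q' ×
    score₁ G P Q ≡ score₁ G P Q' × score₂ G P Q ≡ score₂ G P Q'
  representative {Q} (packing , size) with lists-complete Q
  ... | Q' , Q'∈ , Q≈Q' =
    Q' , subst (λ k → Q' ∈ lists-of-length k) size Q'∈ ,
    (packing-≈ Q≈Q' packing , trans (sym (Pointwise-length Q≈Q')) size) ,
    doubleSum-≈ (sameEdges G) sameEdges-≈ P Q≈Q' , doubleSum-≈ (edgeOverlap G) edgeOverlap-≈ P Q≈Q'

  beats-all₁ : ∀ {Q₁} → (∀ {Q'} → Q' ∈ candidates → Feasible Q' → score₁ G P Q' ≤ score₁ G P Q₁) →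
    ∀ Q → IsPacking G Q → length Q ≡ suc j → score₁ G P Q ≤ score₁ G P Q₁
  beats-all₁ {Q₁} best Q packing size with representative (packing , size)
  ... | Q' , Q'∈ , feasible' , same₁ , _ = subst (_≤ score₁ G P Q₁) (sym same₁) (best Q'∈ feasible')

  Tied : List PT → List PT → Set
  Tied Q₁ Q = Feasible Q × score₁ G P Q ≡ score₁ G P Q₁

  tied? : ∀ Q₁ Q → Dec (Tied Q₁ Q)
  tied? Q₁ Q = feasible? Q ×-dec (score₁ G P Q ℕ.≟ score₁ G P Q₁)

  𝔔₂-element : ∀ {Q₀} → Feasible Q₀ → Σ (List PT) (InQ2 G P j)
  𝔔₂-element feasible₀ with maximize Feasible feasible? (score₁ G P) candidates feasible₀
  ... | Q₁ , feasible₁ , _ , best₁ with maximize (Tied Q₁) (tied? Q₁) (score₂ G P) candidates (feasible₁ , refl)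
  ...   | Q₂ , (feasible₂ , tied₂) , _ , best₂ = Q₂ , (proj₁ feasible₂ , proj₂ feasible₂ , max₁) , max₂
    where
    max₁ : ∀ Q → IsPacking G Q → length Q ≡ suc j → score₁ G P Q ≤ score₁ G P Q₂
    max₁ Q packing size = subst (score₁ G P Q ≤_) (sym tied₂) (beats-all₁ {Q₁} best₁ Q packing size)

    max₂ : ∀ Q → InQ1 G P j Q → score₂ G P Q ≤ score₂ G P Q₂
    max₂ Q (packing , size , optimal) with representative (packing , size)
    ... | Q' , Q'∈ , feasible' , same₁ , same₂ =
      subst (_≤ score₂ G P Q₂) (sym same₂) (best₂ Q'∈ (feasible' , tied'))
      where
      tied' : score₁ G P Q' ≡ score₁ G P Q₁
      tied' = trans (sym same₁)
        (≤-antisym (beats-all₁ {Q₁} best₁ Q packing size) (optimal Q₁ (proj₁ feasible₁) (proj₂ feasible₁)))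

theorem5 : ∀ {n : ℕ} (G : Graph n) (j : ℕ) (P : List (P2 G))
    → IsMaximalPacking G P → length P ≡ j
    → Σ (List (P2 G)) (λ Q → IsPacking G Q × length Q ≡ suc j)
    → Σ (List (P2 G)) (λ Q → InQ2 G P j Q × 5 * j ≤ 2 * commonVertices G P Q)
theorem5 G j P (P-packing , _) P-size (Q₀ , Q₀-feasible) with Optimum.𝔔₂-element G P j Q₀-feasible
... | Q , Q∈𝔔₂ = Q , Q∈𝔔₂ , Exchange.bound G P Q j P-packing P-size Q∈𝔔₂
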